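{- Let $F$ be a field, $n\in\mathbb{N}$, and let $p,q\in\mathbb{N}$ satisfy $p+q\leq n+1$. If $x\in F^{n+1}$ satisfies $\operatorname{rank}(H_{p-1,q}(x))\leq q$, then $\operatorname{rank}(H_{p-1,q}(x))\leq\operatorname{rank}(H_{p,q-1}(x))$.
   Context: $\mathbb{N}=\{0,1,2,\ldots\}$. For $x=(x_0,x_1,\ldots,x_n)\in F^{n+1}$ and integers $p,s\in\{ -1,0,1,\ldots\}$ with $p+s\leq n$, $H_{p,s}(x)$ is the $(p+1)\times(s+1)$ matrix $(x_{i+j})_{0\leq i\leq p,\ 0\leq j\leq s}$ (an empty matrix, of rank $0$, if $p=-1$ or $s=-1$). -}

module Defs where

open import Level using (Level; _⊔_) renaming (suc to lsuc)
open import Data.Nat using (ℕ; zero; suc; _<?_) renaming (_+_ to _+ℕ_)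
open import Data.Fin using (Fin; toℕ; fromℕ<) renaming (zero to fzero; suc to fsuc)
open import Data.Product using (Σ; ∃; _×_; _,_)
open import Relation.Nullary using (¬_; yes; no)
open import Relation.Binary.PropositionalEquality using (_≡_)
open import Function.Definitions using (Injective)
open import Algebra.Bundles using (CommutativeRing)

record Field (c ℓ : Level) : Set (lsuc (c ⊔ ℓ)) where
  field
    commutativeRing : CommutativeRing c ℓ
  open CommutativeRing commutativeRing public
  field
    0≉1     : ¬ (0# ≈ 1#)
    inverse : ∀ x → ¬ (x ≈ 0#) → ∃ λ y → x * y ≈ 1#

module _ {c ℓ : Level} (F : Field c ℓ) where
  open Field F

  sumF : (k : ℕ) → (Fin k → Carrier) → Carrier
  sumF zero    f = 0#
  sumF (suc k) f = f fzero + sumF k (λ j → f (fsuc j))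

  Matrix : ℕ → ℕ → Set c
  Matrix m k = Fin m → Fin k → Carrier

  LinIndep : {m k : ℕ} → (Fin k → Fin m → Carrier) → Set (c ⊔ ℓ)
  LinIndep {m} {k} v =
    (a : Fin k → Carrier) →
    (∀ i → sumF k (λ j → a j * v j i) ≈ 0#) →
    ∀ j → a j ≈ 0#

  cols : {m k r : ℕ} → Matrix m k → (Fin r → Fin k) → Fin r → Fin m → Carrier
  cols A σ t i = A i (σ t)

  HasRank : {m k : ℕ} → Matrix m k → ℕ → Set (c ⊔ ℓ)
  HasRank {m} {k} A r =
    (Σ (Fin r → Fin k) λ σ → Injective _≡_ _≡_ σ × LinIndep (cols A σ)) ×
    ((σ : Fin (suc r) → Fin k) → Injective _≡_ _≡_ σ → ¬ LinIndep (cols A σ))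

  -- x_k for x = (x_0,…,x_n); out-of-range indices (never used under the
  -- hypotheses of the statements) give 0
  entry : {n : ℕ} → (Fin (suc n) → Carrier) → ℕ → Carrier
  entry {n} x k with k <? suc n
  ... | yes k<n = x (fromℕ< k<n)
  ... | no _    = 0#

  -- hankel x a b = H_{a-1,b-1}(x), the a × b matrix (x_{i+j})
  hankel : {n : ℕ} → (Fin (suc n) → Carrier) → (a b : ℕ) → Matrix a b
  hankel x a b i j = entry x (toℕ i +ℕ toℕ j)

Fin′ : ∀ {c ℓ} → Field c ℓ → ℕ → Set c
Fin′ F n = Fin (suc n) → Field.Carrier F

-- Let K be the p × q matrix H_{p-1,q-1}: it is H_{p-1,q} without its last column and
-- H_{p,q-1} without its last row. Choose among the columns of K a basis of its column space.
-- If the last column of H_{p-1,q} lies in their span, rank H_{p-1,q} = rank K ≤ rank H_{p,q-1}.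
-- Otherwise rank H_{p-1,q} ≤ rank K + 1, and each column of H_{p,q-1} is compared, in its last
-- row, with the combination of basis columns that it equals in the rows above. If one of them
-- differs there, it forms with the basis columns rank K + 1 independent columns of H_{p,q-1}.
-- If none does, a vector in the kernel of H_{p,q-1} is already in it as soon as it kills the
-- first p rows; by the Hankel structure the kernel is then invariant under the shift
-- (a₀, …, a_{q-1}) ↦ (0, a₀, …, a_{q-2}), and the independence of the last column of H_{p-1,q}
-- from the basis forces a_{q-1} = 0. So the kernel is trivial and rank H_{p,q-1} = q.
-- Equality in F is not decidable, so these case distinctions are made under double negation;
-- this is harmless because the conclusion is a decidable inequality between natural numbers.

module Submission where

open import Level using (_⊔_)
open import Data.Nat using (ℕ; zero; suc; _≤_; z≤n; s≤s; _≤?_; _∸_) renaming (_+_ to _+ℕ_)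
open import Data.Nat.Properties using (≤-trans; m∸n+n≡m; m+[n∸m]≡n; ≰⇒>; +-suc; m<1+n⇒m≤n; m+1+n≢m)
  renaming (+-identityʳ to +ℕ-identityʳ)
open import Data.Fin using (Fin; zero; suc; toℕ; fromℕ; inject₁; punchIn; punchOut; _≟_; _↑ʳ_)
open import Data.Fin.Relation.Unary.Top using (view; ‵fromℕ; ‵inject₁)
open import Data.Fin.Properties using (punchIn-punchOut; toℕ-inject₁; toℕ-fromℕ; toℕ<n; toℕ-injective)
open import Data.Vec.Functional using (Vector; _∷_; tail; init)
open import Data.Product using (∃; _,_; proj₁; proj₂)
open import Data.Sum using (_⊎_; inj₁; inj₂)
open import Function using (_∘_)
open import Relation.Nullary using (¬_; yes; no)
open import Relation.Nullary.Decidable using (decidable-stable; ¬¬-excluded-middle)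
open import Relation.Nullary.Negation using (contradiction)
open import Relation.Binary.PropositionalEquality as ≡ using (_≡_; _≢_)

open import Function.Definitions using (Injective)
open import Defs

-- the library's ¬¬-Monad lives at a single level
module DoubleNegation where

  infixl 1 _>>=_

  _>>=_ : ∀ {a b} {A : Set a} {B : Set b} → ¬ ¬ A → (A → ¬ ¬ B) → ¬ ¬ B
  (x >>= f) k = x λ a → f a k

  pure : ∀ {a} {A : Set a} → A → ¬ ¬ A
  pure a k = k a

open DoubleNegation

module LinearAlgebra {c ℓ} (F : Field c ℓ) where
  open Field F hiding (zero)
  open import Algebra.Properties.Ring ring using (-1*x≈-x; -‿distribˡ-*; x[y-z]≈xy-xz)
  open import Algebra.Properties.AbelianGroup +-abelianGroup using (inverseˡ-unique; ε⁻¹≈ε)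
  open import Algebra.Properties.CommutativeSemigroup +-commutativeSemigroup using (x∙yz≈y∙xz; xy∙z≈x∙zy)
  open import Algebra.Properties.Semiring.Sum semiring
    using (sum; sum-cong-≋; sum-replicate-zero; ∑-distrib-+; ∑-comm; *-distribˡ-sum; *-distribʳ-sum)
  open import Relation.Binary.Reasoning.Setoid setoid

  private
    variable
      m n k k′ : ℕ
      p u : Vector Carrier m
      v w : Fin n → Vector Carrier m

  1≉0 : ¬ 1# ≈ 0#
  1≉0 = 0≉1 ∘ sym

  cancel-nonzeroʳ : ∀ {x y} → ¬ y ≈ 0# → x * y ≈ 0# → x ≈ 0#
  cancel-nonzeroʳ {x} {y} y≉0 xy≈0 with inverse y y≉0
  ... | y⁻¹ , yy⁻¹≈1 = begin
    x              ≈⟨ *-identityʳ x ⟨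
    x * 1#         ≈⟨ *-congˡ yy⁻¹≈1 ⟨
    x * (y * y⁻¹)  ≈⟨ *-assoc x y y⁻¹ ⟨
    x * y * y⁻¹    ≈⟨ *-congʳ xy≈0 ⟩
    0# * y⁻¹       ≈⟨ zeroˡ y⁻¹ ⟩
    0#             ∎

  +-cancel-zeroˡ : ∀ {x y} → x ≈ 0# → x + y ≈ 0# → y ≈ 0#
  +-cancel-zeroˡ {x} {y} x≈0 x+y≈0 = begin
    y       ≈⟨ +-identityˡ y ⟨
    0# + y  ≈⟨ +-congʳ x≈0 ⟨
    x + y   ≈⟨ x+y≈0 ⟩
    0#      ∎

  +-cancel-zeroʳ : ∀ {x y} → y ≈ 0# → x + y ≈ 0# → x ≈ 0#
  +-cancel-zeroʳ {x} {y} y≈0 x+y≈0 = begin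
    x       ≈⟨ +-identityʳ x ⟨
    x + 0#  ≈⟨ +-congˡ y≈0 ⟨
    x + y   ≈⟨ x+y≈0 ⟩
    0#      ∎

  +-*-cancel : ∀ x y z → x + y * z + - y * z ≈ x
  +-*-cancel x y z = begin
    x + y * z + - y * z      ≈⟨ +-assoc x (y * z) (- y * z) ⟩
    x + (y * z + - y * z)    ≈⟨ +-congˡ (+-congˡ (-‿distribˡ-* y z)) ⟨
    x + (y * z + - (y * z))  ≈⟨ +-congˡ (-‿inverseʳ (y * z)) ⟩
    x + 0#                   ≈⟨ +-identityʳ x ⟩
    x                        ∎

  sum-zero : {f : Vector Carrier n} → (∀ t → f t ≈ 0#) → sum f ≈ 0#
  sum-zero {n} f≈0 = trans (sum-cong-≋ f≈0) (sum-replicate-zero n)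

  sum-neg : (f : Vector Carrier n) → sum (λ t → - f t) ≈ - sum f
  sum-neg f = begin
    sum (λ t → - f t)       ≈⟨ sum-cong-≋ (λ t → -1*x≈-x (f t)) ⟨
    sum (λ t → - 1# * f t)  ≈⟨ *-distribˡ-sum (- 1#) f ⟨
    - 1# * sum f            ≈⟨ -1*x≈-x (sum f) ⟩
    - sum f                 ∎

  lincomb : Vector Carrier n → (Fin n → Vector Carrier m) → Vector Carrier m
  lincomb a v i = sum (λ t → a t * v t i)

  lincomb-+ : (a b : Vector Carrier n) (v : Fin n → Vector Carrier m) (i : Fin m) →
              lincomb (λ t → a t + b t) v i ≈ lincomb a v i + lincomb b v i
  lincomb-+ a b v i = trans (sum-cong-≋ λ t → distribʳ (v t i) (a t) (b t))
                      (∑-distrib-+ (λ t → a t * v t i) (λ t → b t * v t i))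

  lincomb-*ˡ : ∀ x (a : Vector Carrier n) (v : Fin n → Vector Carrier m) (i : Fin m) →
               lincomb (λ t → x * a t) v i ≈ x * lincomb a v i
  lincomb-*ˡ x a v i =
    trans (sum-cong-≋ λ t → *-assoc x (a t) (v t i)) (sym (*-distribˡ-sum x (λ t → a t * v t i)))

  lincomb-congʳ : (a : Vector Carrier n) {i : Fin m} → (∀ t → v t i ≈ w t i) →
                  lincomb a v i ≈ lincomb a w i
  lincomb-congʳ a vᵢ≈wᵢ = sum-cong-≋ λ t → *-congˡ (vᵢ≈wᵢ t)

  lincomb-zeroˡ : {a : Vector Carrier n} → (∀ t → a t ≈ 0#) →
                  (v : Fin n → Vector Carrier m) (i : Fin m) → lincomb a v i ≈ 0#
  lincomb-zeroˡ a≈0 v i = sum-zero λ t → trans (*-congʳ (a≈0 t)) (zeroˡ (v t i))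

  lincomb-zeroʳ : (a : Vector Carrier n) {i : Fin m} → (∀ t → v t i ≈ 0#) → lincomb a v i ≈ 0#
  lincomb-zeroʳ a vᵢ≈0 = sum-zero λ t → trans (*-congˡ (vᵢ≈0 t)) (zeroʳ (a t))

  lincomb-lincomb : (a : Vector Carrier n) (C : Fin n → Vector Carrier k)
                    (w : Fin k → Vector Carrier m) (i : Fin m) →
                    lincomb a (λ t → lincomb (C t) w) i ≈ lincomb (lincomb a C) w i
  lincomb-lincomb a C w i = begin
    sum (λ t → a t * sum (λ l → C t l * w l i))
      ≈⟨ sum-cong-≋ (λ t → *-distribˡ-sum (a t) (λ l → C t l * w l i)) ⟩
    sum (λ t → sum (λ l → a t * (C t l * w l i)))
      ≈⟨ ∑-comm (λ t l → a t * (C t l * w l i)) ⟩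
    sum (λ l → sum (λ t → a t * (C t l * w l i)))
      ≈⟨ sum-cong-≋ (λ l → sum-cong-≋ λ t → *-assoc (a t) (C t l) (w l i)) ⟨
    sum (λ l → sum (λ t → a t * C t l * w l i))
      ≈⟨ sum-cong-≋ (λ l → *-distribʳ-sum (w l i) (λ t → a t * C t l)) ⟨
    sum (λ l → lincomb a C l * w l i)
      ∎

  infix 8 _·_

  _·_ : Vector Carrier n → Vector Carrier n → Carrier
  a · s = sum (λ t → a t * s t)

  addMultiples : Vector Carrier n → Vector Carrier m → (Fin n → Vector Carrier m) →
                 Fin n → Vector Carrier m
  addMultiples s p v t i = v t i + s t * p i

  lincomb-addMultiples : (a s : Vector Carrier n) (p : Vector Carrier m) (v : Fin n → Vector Carrier m)
                         (i : Fin m) → lincomb a (addMultiples s p v) i ≈ lincomb a v i + a · s * p i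
  lincomb-addMultiples a s p v i = begin
    sum (λ t → a t * (v t i + s t * p i))
      ≈⟨ sum-cong-≋ (λ t → trans (distribˡ (a t) (v t i) (s t * p i))
                                 (+-congˡ (sym (*-assoc (a t) (s t) (p i))))) ⟩
    sum (λ t → a t * v t i + a t * s t * p i)
      ≈⟨ ∑-distrib-+ (λ t → a t * v t i) (λ t → a t * s t * p i) ⟩
    lincomb a v i + sum (λ t → a t * s t * p i)
      ≈⟨ +-congˡ (*-distribʳ-sum (p i) (λ t → a t * s t)) ⟨
    lincomb a v i + a · s * p i
      ∎

  Independent : (Fin n → Vector Carrier m) → Set (c ⊔ ℓ)
  Independent v = ∀ a → (∀ i → lincomb a v i ≈ 0#) → ∀ t → a t ≈ 0#

  infix 4 _∈Span_

  _∈Span_ : Vector Carrier m → (Fin n → Vector Carrier m) → Set (c ⊔ ℓ)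
  u ∈Span v = ∃ λ a → ∀ i → u i ≈ lincomb a v i

  rows : (Fin m → Fin k) → (Fin n → Vector Carrier k) → Fin n → Vector Carrier m
  rows ρ v t = v t ∘ ρ

  δ : Fin n → Vector Carrier n
  δ zero    zero    = 1#
  δ zero    (suc _) = 0#
  δ (suc _) zero    = 0#
  δ (suc s) (suc t) = δ s t

  δ-diagonal : (s : Fin n) → δ s s ≡ 1#
  δ-diagonal zero    = ≡.refl
  δ-diagonal (suc s) = δ-diagonal s

  δ-offDiagonal : {s t : Fin n} → s ≢ t → δ s t ≡ 0#
  δ-offDiagonal {s = zero}  {t = zero}  s≢t = contradiction ≡.refl s≢t
  δ-offDiagonal {s = zero}  {t = suc t} _   = ≡.refl
  δ-offDiagonal {s = suc s} {t = zero}  _   = ≡.refl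
  δ-offDiagonal {s = suc s} {t = suc t} s≢t = δ-offDiagonal (s≢t ∘ ≡.cong suc)

  lincomb-δ : (s : Fin n) (v : Fin n → Vector Carrier m) (i : Fin m) → lincomb (δ s) v i ≈ v s i
  lincomb-δ zero    v i =
    trans (+-cong (*-identityˡ (v zero i)) (lincomb-zeroˡ (λ _ → refl) (tail v) i)) (+-identityʳ (v zero i))
  lincomb-δ (suc s) v i =
    trans (+-cong (zeroˡ (v zero i)) (lincomb-δ s (tail v) i)) (+-identityˡ (v (suc s) i))

  Independent-cong : (∀ t i → v t i ≈ w t i) → Independent v → Independent w
  Independent-cong {v = v} {w = w} v≈w ind a aw≈0 =
    ind a λ i → trans (lincomb-congʳ {v = v} {w = w} a (λ t → v≈w t i)) (aw≈0 i)

  Independent-fromRows : (ρ : Fin m → Fin k) → Independent (rows ρ v) → Independent v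
  Independent-fromRows ρ ind a av≈0 = ind a (av≈0 ∘ ρ)

  Independent-tail : Independent (p ∷ v) → Independent v
  Independent-tail {p = p} {v = v} ind a av≈0 t =
    ind (0# ∷ a) (λ i → trans (+-cong (zeroˡ (p i)) (av≈0 i)) (+-identityʳ 0#)) (suc t)

  Independent-swap : Independent (p ∷ u ∷ v) → Independent (u ∷ p ∷ v)
  Independent-swap {p = p} {u = u} {v = v} ind a a≈0 = swapped
    where
    a′ : Vector Carrier _
    a′ = a (suc zero) ∷ a zero ∷ tail (tail a)

    a′≈0 : ∀ t → a′ t ≈ 0#
    a′≈0 = ind a′ λ i →
      trans (x∙yz≈y∙xz (a (suc zero) * p i) (a zero * u i) (lincomb (tail (tail a)) v i)) (a≈0 i)

    swapped : ∀ t → a t ≈ 0#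
    swapped zero          = a′≈0 (suc zero)
    swapped (suc zero)    = a′≈0 zero
    swapped (suc (suc t)) = a′≈0 (suc (suc t))

  Independent-addMultiples : (s : Vector Carrier n) → Independent (p ∷ v) →
                             Independent (p ∷ addMultiples s p v)
  Independent-addMultiples {p = p} {v = v} s ind a a≈0 = conclude
    where
    b : Vector Carrier _
    b = tail a

    a′ : Vector Carrier _
    a′ = (a zero + b · s) ∷ b

    a′≈0 : ∀ t → a′ t ≈ 0#
    a′≈0 = ind a′ λ i → begin
      (a zero + b · s) * p i + lincomb b v i          ≈⟨ +-congʳ (distribʳ (p i) (a zero) (b · s)) ⟩
      a zero * p i + b · s * p i + lincomb b v i      ≈⟨ xy∙z≈x∙zy (a zero * p i) (b · s * p i) (lincomb b v i) ⟩
      a zero * p i + (lincomb b v i + b · s * p i)    ≈⟨ +-congˡ (lincomb-addMultiples b s p v i) ⟨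
      a zero * p i + lincomb b (addMultiples s p v) i ≈⟨ a≈0 i ⟩
      0#                                              ∎

    conclude : ∀ t → a t ≈ 0#
    conclude zero    =
      +-cancel-zeroʳ (sum-zero λ t → trans (*-congʳ (a′≈0 (suc t))) (zeroˡ (s t))) (a′≈0 zero)
    conclude (suc t) = a′≈0 (suc t)

  Independent-∷-pivot : (i : Fin m) → ¬ p i ≈ 0# → (∀ t → v t i ≈ 0#) →
                        Independent v → Independent (p ∷ v)
  Independent-∷-pivot {p = p} {v = v} i pᵢ≉0 vᵢ≈0 ind a a≈0 = conclude
    where
    a₀≈0 : a zero ≈ 0#
    a₀≈0 = cancel-nonzeroʳ pᵢ≉0 (+-cancel-zeroʳ (lincomb-zeroʳ {v = v} (tail a) vᵢ≈0) (a≈0 i))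

    conclude : ∀ t → a t ≈ 0#
    conclude zero    = a₀≈0
    conclude (suc t) = ind (tail a) (λ j → +-cancel-zeroˡ (trans (*-congʳ a₀≈0) (zeroˡ (p j))) (a≈0 j)) t

  head-nonzero : Independent {n = suc n} v → ¬ (∀ i → v zero i ≈ 0#)
  head-nonzero {v = v} ind v₀≈0 = 1≉0 (ind (δ zero) (λ i → trans (lincomb-δ zero v i) (v₀≈0 i)) zero)

  zero-or-nonzero : (u : Vector Carrier m) → ¬ ¬ ((∀ i → u i ≈ 0#) ⊎ ∃ λ i → ¬ u i ≈ 0#)
  zero-or-nonzero {zero}  u = pure (inj₁ λ ())
  zero-or-nonzero {suc m} u = do
    yes u₀≈0 ← ¬¬-excluded-middle
      where no u₀≉0 → pure (inj₂ (zero , u₀≉0))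
    inj₁ tail≈0 ← zero-or-nonzero (tail u)
      where inj₂ (i , uᵢ≉0) → pure (inj₂ (suc i , uᵢ≉0))
    pure (inj₁ λ { zero → u₀≈0 ; (suc i) → tail≈0 i })

  pivot : Independent {n = suc n} v → ¬ ¬ (∃ λ i → ¬ v zero i ≈ 0#)
  pivot {v = v} ind = do
    inj₂ nonzero ← zero-or-nonzero (v zero)
      where inj₁ v₀≈0 → contradiction v₀≈0 (head-nonzero {v = v} ind)
    pure nonzero

  clearing : Fin m → Carrier → (Fin n → Vector Carrier m) → Vector Carrier n
  clearing i γ v t = - (v t i * γ)

  addMultiples-clearing : ∀ {i γ} → p i * γ ≈ 1# → ∀ t → addMultiples (clearing i γ v) p v t i ≈ 0#
  addMultiples-clearing {p = p} {v = v} {i} {γ} pᵢγ≈1 t = begin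
    v t i + - (v t i * γ) * p i  ≈⟨ +-congˡ (-‿distribˡ-* (v t i * γ) (p i)) ⟨
    v t i + - (v t i * γ * p i)  ≈⟨ +-congˡ (-‿cong (*-assoc (v t i) γ (p i))) ⟩
    v t i + - (v t i * (γ * p i)) ≈⟨ +-congˡ (-‿cong (*-congˡ (trans (*-comm γ (p i)) pᵢγ≈1))) ⟩
    v t i + - (v t i * 1#)        ≈⟨ +-congˡ (-‿cong (*-identityʳ (v t i))) ⟩
    v t i + - v t i               ≈⟨ -‿inverseʳ (v t i) ⟩
    0#                            ∎

  ∈Span-∷ : u ∈Span v → u ∈Span (p ∷ v)
  ∈Span-∷ {u = u} {v = v} {p = p} (a , u≈av) =
    0# ∷ a , λ i → trans (u≈av i) (sym (trans (+-congʳ (zeroˡ (p i))) (+-identityˡ (lincomb a v i))))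

  ∈Span-head : p ∈Span (p ∷ v)
  ∈Span-head {p = p} {v = v} = δ zero , λ i → sym (lincomb-δ zero (p ∷ v) i)

  ∈Span-∷-addMultiples : ∀ μ s (α : Vector Carrier n) →
                         (∀ i → u i + μ * p i ≈ lincomb α (addMultiples s p v) i) → u ∈Span (p ∷ v)
  ∈Span-∷-addMultiples {u = u} {p = p} {v = v} μ s α u+μp≈ = (α · s - μ) ∷ α , λ i → begin
    u i                                              ≈⟨ +-*-cancel (u i) μ (p i) ⟨
    u i + μ * p i + - μ * p i                        ≈⟨ +-congʳ (u+μp≈ i) ⟩
    lincomb α (addMultiples s p v) i + - μ * p i     ≈⟨ +-congʳ (lincomb-addMultiples α s p v i) ⟩
    lincomb α v i + α · s * p i + - μ * p i          ≈⟨ +-assoc (lincomb α v i) (α · s * p i) (- μ * p i) ⟩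
    lincomb α v i + (α · s * p i + - μ * p i)        ≈⟨ +-congˡ (distribʳ (p i) (α · s) (- μ)) ⟨
    lincomb α v i + (α · s - μ) * p i                ≈⟨ +-comm (lincomb α v i) ((α · s - μ) * p i) ⟩
    (α · s - μ) * p i + lincomb α v i                ∎

  independent-or-spanned : {v : Fin n → Vector Carrier m} → Independent v →
                           (u : Vector Carrier m) → ¬ ¬ (u ∈Span v ⊎ Independent (u ∷ v))
  independent-or-spanned {n = zero} {v = v} _ u = do
    inj₂ (i , uᵢ≉0) ← zero-or-nonzero u
      where inj₁ u≈0 → pure (inj₁ ((λ ()) , u≈0))
    pure (inj₂ (Independent-∷-pivot {v = v} i uᵢ≉0 (λ ()) (λ _ _ ())))
  independent-or-spanned {n = suc n} {v = v} ind u = do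
    (i , v₀ᵢ≉0) ← pivot {v = v} ind
    let (γ , v₀ᵢγ≈1) = inverse (v zero i) v₀ᵢ≉0
    eliminate i γ v₀ᵢγ≈1 v₀ᵢ≉0
    where
    -- Gaussian elimination of coordinate i with the pivot v zero
    eliminate : ∀ i γ → v zero i * γ ≈ 1# → ¬ v zero i ≈ 0# → ¬ ¬ (u ∈Span v ⊎ Independent (u ∷ v))
    eliminate i γ v₀ᵢγ≈1 v₀ᵢ≉0 = do
      r ← independent-or-spanned (Independent-tail {p = v zero} (Independent-addMultiples (tail s) ind))
                                 (uv′ zero)
      pure (recover r)
      where
      uv : Fin (suc n) → Vector Carrier _
      uv = u ∷ tail v

      s : Vector Carrier (suc n)
      s = clearing i γ uv

      uv′ : Fin (suc n) → Vector Carrier _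
      uv′ = addMultiples s (v zero) uv

      recover : uv′ zero ∈Span tail uv′ ⊎ Independent uv′ → u ∈Span v ⊎ Independent (u ∷ v)
      recover (inj₁ (α , uv′₀≈)) = inj₁ (∈Span-∷-addMultiples (s zero) (tail s) α uv′₀≈)
      recover (inj₂ ind′) = inj₂ (Independent-swap {p = v zero} {u = u} {v = tail v} restored)
        where
        cleared : Independent (v zero ∷ uv′)
        cleared = Independent-∷-pivot {p = v zero} {v = uv′} i v₀ᵢ≉0
                    (addMultiples-clearing {p = v zero} {v = uv} v₀ᵢγ≈1) ind′

        undo : ∀ t j → (v zero ∷ addMultiples (λ t → - s t) (v zero) uv′) t j ≈ (v zero ∷ uv) t j
        undo zero    j = refl
        undo (suc t) j = +-*-cancel (uv t j) (s t) (v zero j)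

        restored : Independent (v zero ∷ uv)
        restored = Independent-cong undo
                     (Independent-addMultiples {p = v zero} {v = uv′} (λ t → - s t) cleared)

  Independent-dropRow : {v : Fin n → Vector Carrier (suc m)} (i : Fin (suc m)) → (∀ t → v t i ≈ 0#) →
                        Independent v → Independent (rows (punchIn i) v)
  Independent-dropRow {v = v} i vᵢ≈0 ind a a≈0 = ind a lincomb≈0
    where
    lincomb≈0 : ∀ j → lincomb a v j ≈ 0#
    lincomb≈0 j with i ≟ j
    ... | yes ≡.refl = lincomb-zeroʳ {v = v} a vᵢ≈0
    ... | no i≢j     = ≡.subst (λ j → lincomb a v j ≈ 0#) (punchIn-punchOut i≢j) (a≈0 (punchOut i≢j))

  Independent⇒≤ : {v : Fin n → Vector Carrier m} → Independent v → n ≤ m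
  Independent⇒≤ {n = zero} _ = z≤n
  Independent⇒≤ {n = suc n} {m = zero} ind = contradiction (ind (λ _ → 1#) (λ ()) zero) 1≉0
  Independent⇒≤ {n = suc n} {m = suc m} {v = v} ind = decidable-stable (suc n ≤? suc m) do
    (i , v₀ᵢ≉0) ← pivot {v = v} ind
    let (γ , v₀ᵢγ≈1) = inverse (v zero i) v₀ᵢ≉0
        cleared = Independent-tail {p = v zero}
                    (Independent-addMultiples {p = v zero} {v = tail v} (clearing i γ (tail v)) ind)
    pure (s≤s (Independent⇒≤
      (Independent-dropRow i (addMultiples-clearing {p = v zero} {v = tail v} v₀ᵢγ≈1) cleared)))

  Independent-coefficients : {v : Fin n → Vector Carrier m} {w : Fin k → Vector Carrier m}
                             (C : Fin n → Vector Carrier k) → (∀ t i → v t i ≈ lincomb (C t) w i) →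
                             Independent v → Independent C
  Independent-coefficients {v = v} {w = w} C v≈Cw ind a aC≈0 = ind a λ i → begin
    lincomb a v i
      ≈⟨ lincomb-congʳ {v = v} {w = λ t → lincomb (C t) w} a (λ t → v≈Cw t i) ⟩
    lincomb a (λ t → lincomb (C t) w) i  ≈⟨ lincomb-lincomb a C w i ⟩
    lincomb (lincomb a C) w i            ≈⟨ lincomb-zeroˡ aC≈0 w i ⟩
    0#                                   ∎

  Independent-∈Span⇒≤ : {v : Fin n → Vector Carrier m} {w : Fin k → Vector Carrier m} →
                        (∀ t → v t ∈Span w) → Independent v → n ≤ k
  Independent-∈Span⇒≤ v∈w ind =
    Independent⇒≤ (Independent-coefficients (proj₁ ∘ v∈w) (proj₂ ∘ v∈w) ind)

  record Basis (w : Fin k → Vector Carrier m) : Set (c ⊔ ℓ) where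
    field
      size        : ℕ
      index       : Fin size → Fin k
      independent : Independent (w ∘ index)
      spans       : ∀ j → w j ∈Span (w ∘ index)

  basis : (w : Fin k → Vector Carrier m) → ¬ ¬ Basis w
  basis {k = zero}  w = pure record { size = 0 ; index = λ () ; independent = λ _ _ () ; spans = λ () }
  basis {k = suc k} w = do
    B ← basis (tail w)
    r ← independent-or-spanned (Basis.independent B) (w zero)
    pure (extend B r)
    where
    extend : (B : Basis (tail w)) → let open Basis B in
             w zero ∈Span (tail w ∘ index) ⊎ Independent (w zero ∷ (tail w ∘ index)) → Basis w
    extend B (inj₁ w₀∈span) = record
      { size = size ; index = suc ∘ index ; independent = independent
      ; spans = λ { zero → w₀∈span ; (suc j) → spans j } }
      where open Basis B
    extend B (inj₂ ind) = record
      { size = suc size ; index = zero ∷ (suc ∘ index) ; independent = ind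
      ; spans = λ { zero → ∈Span-head ; (suc j) → ∈Span-∷ (spans j) } }
      where open Basis B

  Independent-∷-newRow : {v : Fin n → Vector Carrier k} (ρ : Fin m → Fin k) (r : Fin k)
                         (α : Vector Carrier n) →
                         Independent (rows ρ v) → (∀ i → u (ρ i) ≈ lincomb α v (ρ i)) →
                         ¬ u r - lincomb α v r ≈ 0# → Independent (u ∷ v)
  Independent-∷-newRow {u = u} {v = v} ρ r α ind u≈αv residual≉0 a a≈0 = conclude
    where
    b : Vector Carrier _
    b t = a (suc t) + a zero * α t

    b-lincomb : ∀ j → lincomb b v j ≈ lincomb (tail a) v j + a zero * lincomb α v j
    b-lincomb j =
      trans (lincomb-+ (tail a) (λ t → a zero * α t) v j) (+-congˡ (lincomb-*ˡ (a zero) α v j))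

    b≈0 : ∀ t → b t ≈ 0#
    b≈0 = ind b λ i → begin
      lincomb b v (ρ i)                                      ≈⟨ b-lincomb (ρ i) ⟩
      lincomb (tail a) v (ρ i) + a zero * lincomb α v (ρ i)  ≈⟨ +-congˡ (*-congˡ (u≈αv i)) ⟨
      lincomb (tail a) v (ρ i) + a zero * u (ρ i)            ≈⟨ +-comm _ _ ⟩
      a zero * u (ρ i) + lincomb (tail a) v (ρ i)            ≈⟨ a≈0 (ρ i) ⟩
      0#                                                     ∎

    a₀-residual≈0 : a zero * (u r - lincomb α v r) ≈ 0#
    a₀-residual≈0 = begin
      a zero * (u r - lincomb α v r)
        ≈⟨ x[y-z]≈xy-xz (a zero) (u r) (lincomb α v r) ⟩
      a zero * u r - a zero * lincomb α v r
        ≈⟨ +-congˡ (inverseˡ-unique _ _ (trans (sym (b-lincomb r)) (lincomb-zeroˡ b≈0 v r))) ⟨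
      a zero * u r + lincomb (tail a) v r
        ≈⟨ a≈0 r ⟩
      0# ∎

    a₀≈0 : a zero ≈ 0#
    a₀≈0 = cancel-nonzeroʳ residual≉0 a₀-residual≈0

    conclude : ∀ t → a t ≈ 0#
    conclude zero    = a₀≈0
    conclude (suc t) = +-cancel-zeroʳ (trans (*-congʳ a₀≈0) (zeroˡ (α t))) (b≈0 t)

  lincomb≈0-fromRows : {w : Fin k → Vector Carrier m} {u : Fin n → Vector Carrier m}
                       (ρ : Fin k′ → Fin m) (A : Fin n → Vector Carrier k) →
                       Independent (rows ρ w) → (∀ t i → u t i ≈ lincomb (A t) w i) →
                       (a : Vector Carrier n) → (∀ i → lincomb a u (ρ i) ≈ 0#) → ∀ i → lincomb a u i ≈ 0#
  lincomb≈0-fromRows {w = w} {u = u} ρ A ind u≈Aw a au≈0 i =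
    trans (expand i) (lincomb-zeroˡ coefficients≈0 w i)
    where
    expand : ∀ i → lincomb a u i ≈ lincomb (lincomb a A) w i
    expand i = trans (lincomb-congʳ {v = u} {w = λ t → lincomb (A t) w} a (λ t → u≈Aw t i))
                     (lincomb-lincomb a A w i)

    coefficients≈0 : ∀ l → lincomb a A l ≈ 0#
    coefficients≈0 = ind (lincomb a A) λ i → trans (sym (expand (ρ i))) (au≈0 i)

  lincomb-neg : (a : Vector Carrier n) (v : Fin n → Vector Carrier m) (i : Fin m) →
                lincomb (λ t → - a t) v i ≈ - lincomb a v i
  lincomb-neg a v i =
    trans (sum-cong-≋ λ t → sym (-‿distribˡ-* (a t) (v t i))) (sum-neg (λ t → a t * v t i))

  Independent-injective : {w : Fin k → Vector Carrier m} (κ : Fin n → Fin k) →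
                          Independent (w ∘ κ) → Injective _≡_ _≡_ κ
  Independent-injective {w = w} κ ind {s} {t} κs≡κt with s ≟ t
  ... | yes s≡t = s≡t
  ... | no s≢t  = contradiction (ind a a≈0 s) aₛ≉0
    where
    a : Vector Carrier _
    a u = δ s u - δ t u

    a≈0 : ∀ i → lincomb a (w ∘ κ) i ≈ 0#
    a≈0 i = begin
      lincomb a (w ∘ κ) i
        ≈⟨ lincomb-+ (δ s) (λ u → - δ t u) (w ∘ κ) i ⟩
      lincomb (δ s) (w ∘ κ) i + lincomb (λ u → - δ t u) (w ∘ κ) i
        ≈⟨ +-congˡ (lincomb-neg (δ t) (w ∘ κ) i) ⟩
      lincomb (δ s) (w ∘ κ) i - lincomb (δ t) (w ∘ κ) i
        ≈⟨ +-cong (lincomb-δ s (w ∘ κ) i) (-‿cong (lincomb-δ t (w ∘ κ) i)) ⟩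
      w (κ s) i - w (κ t) i
        ≈⟨ +-congˡ (-‿cong (reflexive (≡.cong (λ j → w j i) κs≡κt))) ⟨
      w (κ s) i - w (κ s) i
        ≈⟨ -‿inverseʳ (w (κ s) i) ⟩
      0# ∎

    aₛ≉0 : ¬ a s ≈ 0#
    aₛ≉0 aₛ≈0 = 1≉0 (begin
      1#             ≈⟨ +-identityʳ 1# ⟨
      1# + 0#        ≈⟨ +-congˡ ε⁻¹≈ε ⟨
      1# - 0#        ≈⟨ reflexive (≡.cong₂ (λ x y → x - y) (δ-diagonal s) (δ-offDiagonal (s≢t ∘ ≡.sym))) ⟨
      δ s s - δ t s  ≈⟨ aₛ≈0 ⟩
      0#             ∎)

  Independent-↑ʳ : ∀ d {v : Fin (d +ℕ n) → Vector Carrier m} → Independent v →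
                   Independent (λ t → v (d ↑ʳ t))
  Independent-↑ʳ zero    ind = ind
  Independent-↑ʳ (suc d) {v} ind = Independent-↑ʳ d (Independent-tail {p = v zero} {v = tail v} ind)

  sumF≡sum : ∀ k (f : Vector Carrier k) → sumF F k f ≡ sum f
  sumF≡sum zero    f = ≡.refl
  sumF≡sum (suc k) f = ≡.cong (f zero +_) (sumF≡sum k (tail f))

  LinIndep⇒Independent : {v : Fin n → Vector Carrier m} → LinIndep F v → Independent v
  LinIndep⇒Independent {n = n} {v = v} li a a≈0 =
    li a λ i → trans (reflexive (sumF≡sum n (λ t → a t * v t i))) (a≈0 i)

  Independent⇒LinIndep : {v : Fin n → Vector Carrier m} → Independent v → LinIndep F v
  Independent⇒LinIndep {n = n} {v = v} ind a a≈0 =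
    ind a λ i → trans (reflexive (≡.sym (sumF≡sum n (λ t → a t * v t i)))) (a≈0 i)

  rank-witness : ∀ {r} {A : Matrix F m k} → HasRank F A r →
                 ∃ λ (σ : Fin r → Fin k) → Independent (cols F A σ)
  rank-witness ((σ , _ , li) , _) = σ , LinIndep⇒Independent li

  rank-maximal : ∀ {r N} {A : Matrix F m k} → HasRank F A r →
                 (κ : Fin N → Fin k) → Independent (cols F A κ) → N ≤ r
  rank-maximal {r = r} {N = N} {A = A} (_ , maximal) κ ind with N ≤? r
  ... | yes N≤r = N≤r
  ... | no N≰r with N ∸ suc r | m∸n+n≡m (≰⇒> N≰r)
  ...   | d | ≡.refl = contradiction (Independent⇒LinIndep {v = cols F A σ} independent)
                                     (maximal σ (Independent-injective {w = λ j i → A i j} σ independent))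
    where
    σ : Fin (suc r) → _
    σ = κ ∘ (d ↑ʳ_)

    independent : Independent (cols F A σ)
    independent = Independent-↑ʳ d ind

module HankelColumns {c ℓ} (F : Field c ℓ) (X : ℕ → Field.Carrier F) where
  open Field F hiding (zero)
  open LinearAlgebra F
  open import Algebra.Properties.AbelianGroup +-abelianGroup using (x∙y⁻¹≈ε⇒x≈y)
  open import Algebra.Properties.Semiring.Sum semiring using (sum-cong-≋; sum-init-last)
  open import Relation.Binary.Reasoning.Setoid setoid

  private
    variable
      m n q : ℕ

  column : (m j : ℕ) → Vector Carrier m
  column m j i = X (toℕ i +ℕ j)

  hankelColumns : (m k : ℕ) → Fin k → Vector Carrier m
  hankelColumns m k j = column m (toℕ j)

  column-inject₁ : ∀ j (i : Fin m) → column (suc m) j (inject₁ i) ≈ column m j i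
  column-inject₁ j i = reflexive (≡.cong (λ l → X (l +ℕ j)) (toℕ-inject₁ i))

  Independent-addRow : (κ : Fin n → ℕ) → Independent (λ t → column m (κ t)) →
                       Independent (λ t → column (suc m) (κ t))
  Independent-addRow κ ind =
    Independent-fromRows inject₁ (Independent-cong (λ t i → sym (column-inject₁ (κ t) i)) ind)

  ∈Span-lastColumn : ∀ {k} {u : Fin k → Vector Carrier m} → column m q ∈Span u →
                     (∀ j → hankelColumns m q j ∈Span u) → ∀ j → hankelColumns m (suc q) j ∈Span u
  ∈Span-lastColumn {m = m} {q = q} {u = u} q∈u left∈u j with view j
  ... | ‵fromℕ     = ≡.subst (λ l → column m l ∈Span u) (≡.sym (toℕ-fromℕ q)) q∈u
  ... | ‵inject₁ i = ≡.subst (λ l → column m l ∈Span u) (≡.sym (toℕ-inject₁ i)) (left∈u i)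

  private
    suc-+-toℕ : ∀ x {j : Fin n} {l} → toℕ j ≡ l → suc x +ℕ toℕ j ≡ x +ℕ suc l
    suc-+-toℕ x {l = l} toℕj≡l = ≡.trans (≡.cong (suc x +ℕ_) toℕj≡l) (≡.sym (+-suc x l))

  lincomb-sucRow : (a : Vector Carrier (suc q)) (i : Fin m) →
                   lincomb a (hankelColumns (suc m) (suc q)) (suc i) ≈
                   lincomb (init a) (tail (hankelColumns m (suc q))) i + a (fromℕ q) * column m (suc q) i
  lincomb-sucRow {q = q} a i = trans (sum-init-last (λ k → a k * X (suc (toℕ i) +ℕ toℕ k)))
    (+-cong (sum-cong-≋ {q} λ k → *-congˡ {a (inject₁ k)}
                                     (reflexive (≡.cong X (suc-+-toℕ (toℕ i) (toℕ-inject₁ k)))))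
            (*-congˡ {a (fromℕ q)} (reflexive (≡.cong X (suc-+-toℕ (toℕ i) (toℕ-fromℕ q))))))

  Independent-hankelColumns :
    (∀ a → (∀ i → lincomb a (hankelColumns (suc m) (suc q)) (inject₁ i) ≈ 0#) →
           ∀ i → lincomb a (hankelColumns (suc m) (suc q)) i ≈ 0#) →
    (∀ a → (∀ i → lincomb a (hankelColumns (suc m) (suc q)) i ≈ 0#) → a (fromℕ q) ≈ 0#) →
    Independent (hankelColumns (suc m) (suc q))
  Independent-hankelColumns {m = m} {q = q} fromTopRows last≈0 a a≈0 t =
    vanish (q ∸ toℕ t) a a≈0 t (m+[n∸m]≡n (m<1+n⇒m≤n (toℕ<n t)))
    where
    H : Fin (suc q) → Vector Carrier (suc m)
    H = hankelColumns (suc m) (suc q)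

    shift : ∀ {a} → (∀ i → lincomb a H i ≈ 0#) → ∀ i → lincomb (0# ∷ init a) H i ≈ 0#
    shift {a} ker = fromTopRows (0# ∷ init a) λ i → begin
      0# * H zero (inject₁ i) + lincomb (init a) (tail H) (inject₁ i)
        ≈⟨ +-congʳ (zeroˡ (H zero (inject₁ i))) ⟩
      0# + lincomb (init a) (tail H) (inject₁ i)
        ≈⟨ +-identityˡ _ ⟩
      lincomb (init a) (tail H) (inject₁ i)
        ≈⟨ lincomb-congʳ {v = rows inject₁ (tail H)} {w = tail (hankelColumns m (suc q))} (init a)
                         (λ k → column-inject₁ (suc (toℕ k)) i) ⟩
      lincomb (init a) (tail (hankelColumns m (suc q))) i
        ≈⟨ +-cancel-zeroʳ (trans (*-congʳ (last≈0 a ker)) (zeroˡ _))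
                          (trans (sym (lincomb-sucRow a i)) (ker (suc i))) ⟩
      0#  ∎

    -- after s shifts, entry t of a kernel vector has become the last one
    vanish : ∀ s a → (∀ i → lincomb a H i ≈ 0#) → ∀ t → toℕ t +ℕ s ≡ q → a t ≈ 0#
    vanish zero    a ker t t+0≡q = ≡.subst (λ t → a t ≈ 0#) fromℕ≡t (last≈0 a ker)
      where
      fromℕ≡t : fromℕ q ≡ t
      fromℕ≡t = toℕ-injective (≡.trans (toℕ-fromℕ q) (≡.trans (≡.sym t+0≡q) (+ℕ-identityʳ (toℕ t))))
    vanish (suc s) a ker t t+s+1≡q with view t
    ... | ‵fromℕ      =
      contradiction (≡.trans (≡.cong (_+ℕ suc s) (≡.sym (toℕ-fromℕ q))) t+s+1≡q) (m+1+n≢m q)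
    ... | ‵inject₁ t′ = vanish s (0# ∷ init a) (shift {a} ker) (suc t′)
      (≡.trans (≡.sym (+-suc (toℕ t′) s))
               (≡.trans (≡.cong (_+ℕ suc s) (≡.sym (toℕ-inject₁ t′))) t+s+1≡q))

  module _ {p q : ℕ} (B : Basis (hankelColumns p q)) where
    open Basis B renaming (size to g; index to β)

    coefficients : Fin q → Vector Carrier g
    coefficients j = proj₁ (spans j)

    basisColumns : Fin g → Vector Carrier (suc p)
    basisColumns = hankelColumns (suc p) q ∘ β

    basisColumns-topRows : Independent (rows inject₁ basisColumns)
    basisColumns-topRows = Independent-cong (λ t i → sym (column-inject₁ (toℕ (β t)) i)) independent

    spanned-topRows : ∀ j i → hankelColumns (suc p) q j (inject₁ i) ≈
                              lincomb (coefficients j) basisColumns (inject₁ i)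
    spanned-topRows j i = begin
      hankelColumns (suc p) q j (inject₁ i)  ≈⟨ column-inject₁ (toℕ j) i ⟩
      hankelColumns p q j i                  ≈⟨ proj₂ (spans j) i ⟩
      lincomb (coefficients j) (hankelColumns p q ∘ β) i
        ≈⟨ lincomb-congʳ {v = hankelColumns p q ∘ β} {w = rows inject₁ basisColumns} (coefficients j)
                         (λ t → sym (column-inject₁ (toℕ (β t)) i)) ⟩
      lincomb (coefficients j) basisColumns (inject₁ i) ∎

    residual : Vector Carrier q
    residual j = hankelColumns (suc p) q j (fromℕ p) - lincomb (coefficients j) basisColumns (fromℕ p)

    Independent-residual≉0 : ∀ j → ¬ residual j ≈ 0# → Independent (hankelColumns (suc p) q ∘ (j ∷ β))
    Independent-residual≉0 j =
      Independent-∷-newRow inject₁ (fromℕ p) (coefficients j) basisColumns-topRows (spanned-topRows j)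

    spanned : (∀ j → residual j ≈ 0#) →
              ∀ j i → hankelColumns (suc p) q j i ≈ lincomb (coefficients j) basisColumns i
    spanned residual≈0 j i with view i
    ... | ‵fromℕ     = x∙y⁻¹≈ε⇒x≈y _ _ (residual≈0 j)
    ... | ‵inject₁ i′ = spanned-topRows j i′

    lincomb≈0-fromTopRows : (∀ j → residual j ≈ 0#) → ∀ a →
                            (∀ i → lincomb a (hankelColumns (suc p) q) (inject₁ i) ≈ 0#) →
                            ∀ i → lincomb a (hankelColumns (suc p) q) i ≈ 0#
    lincomb≈0-fromTopRows residual≈0 =
      lincomb≈0-fromRows inject₁ coefficients basisColumns-topRows (spanned residual≈0)

  lastCoefficient≈0 : ∀ {p q} (B : Basis (hankelColumns p (suc q))) →
                      Independent (column p (suc q) ∷ (hankelColumns p (suc q) ∘ Basis.index B)) →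
                      ∀ a → (∀ i → lincomb a (hankelColumns (suc p) (suc q)) i ≈ 0#) → a (fromℕ q) ≈ 0#
  lastCoefficient≈0 {p} {q} B ind a ker = ind (a (fromℕ q) ∷ b) combination≈0 zero
    where
    open Basis B renaming (index to β)

    left : Fin (suc q) → Vector Carrier p
    left = hankelColumns p (suc q)

    b : Vector Carrier (Basis.size B)
    b = lincomb (init a) (tail (coefficients B))

    combination≈0 : ∀ i → a (fromℕ q) * column p (suc q) i + lincomb b (left ∘ β) i ≈ 0#
    combination≈0 i = begin
      a (fromℕ q) * column p (suc q) i + lincomb b (left ∘ β) i
        ≈⟨ +-comm _ _ ⟩
      lincomb b (left ∘ β) i + a (fromℕ q) * column p (suc q) i
        ≈⟨ +-congʳ (lincomb-lincomb (init a) (tail (coefficients B)) (left ∘ β) i) ⟨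
      lincomb (init a) (λ k → lincomb (coefficients B (suc k)) (left ∘ β)) i + a (fromℕ q) * column p (suc q) i
        ≈⟨ +-congʳ (lincomb-congʳ {v = λ k → lincomb (coefficients B (suc k)) (left ∘ β)} {w = tail left}
                                  (init a) (λ k → sym (proj₂ (spans (suc k)) i))) ⟩
      lincomb (init a) (tail left) i + a (fromℕ q) * column p (suc q) i
        ≈⟨ lincomb-sucRow a i ⟨
      lincomb a (hankelColumns (suc p) (suc q)) (suc i)
        ≈⟨ ker (suc i) ⟩
      0# ∎

  rank-bound : ∀ p q {r₁ r₂} (σ : Fin r₁ → Fin (suc q)) → Independent (hankelColumns p (suc q) ∘ σ) →
               (∀ {N} (κ : Fin N → Fin q) → Independent (hankelColumns (suc p) q ∘ κ) → N ≤ r₂) →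
               r₁ ≤ q → r₁ ≤ r₂
  rank-bound p zero    σ _ _ r₁≤0 = ≤-trans r₁≤0 z≤n
  rank-bound p (suc q) {r₁} {r₂} σ indσ maximal r₁≤q = decidable-stable (r₁ ≤? r₂) do
    B ← basis (hankelColumns p (suc q))
    let open Basis B renaming (index to β)
        extended = column p (suc q) ∷ (hankelColumns p (suc q) ∘ β)
    inj₂ indExtended ← independent-or-spanned independent (column p (suc q))
      where inj₁ last∈span → pure (≤-trans
              (Independent-∈Span⇒≤ (∈Span-lastColumn last∈span spans ∘ σ) indσ)
              (maximal β (Independent-addRow (toℕ ∘ β) independent)))
    inj₂ (j , residualⱼ≉0) ← zero-or-nonzero (residual B)
      where inj₁ residual≈0 → pure (≤-trans r₁≤q (maximal (λ j → j)
              (Independent-hankelColumns (lincomb≈0-fromTopRows B residual≈0) (lastCoefficient≈0 B indExtended))))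
    pure (≤-trans
      (Independent-∈Span⇒≤ {w = extended}
        (∈Span-lastColumn {u = extended} ∈Span-head (∈Span-∷ ∘ spans) ∘ σ) indσ)
      (maximal (j ∷ β) (Independent-residual≉0 B j residualⱼ≉0)))

open import Data.Nat using (_+_)

-- The bound p + q ≤ n + 1 only keeps the entries of both matrices among x₀, …, xₙ; the
-- argument works for every sequence, in particular for `entry`, which pads x with zeros.
lemma2p2 : ∀ {c ℓ} (F : Field c ℓ) (n p q : ℕ) → p + q ≤ suc n →
    (x : Fin′ F n) → (r₁ r₂ : ℕ) →
    HasRank F (hankel F x p (suc q)) r₁ →
    HasRank F (hankel F x (suc p) q) r₂ →
    r₁ ≤ q → r₁ ≤ r₂
lemma2p2 F n p q _ x r₁ r₂ rank₁ rank₂ r₁≤q =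
  let σ , indσ = rank-witness {A = hankel F x p (suc q)} rank₁
  in rank-bound p q σ indσ (rank-maximal {A = hankel F x (suc p) q} rank₂) r₁≤q
  where
  open LinearAlgebra F
  open HankelColumns F (entry F x)
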